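{- Let $P_1 \in \mathcal{C}(G_n)$ and $P_2\in\mathcal{S}(P_1)$. If $T \subseteq Q_{n+1}$ with $T \neq \emptyset$ and $k \notin T$, then $T \notin \mathrm{char}(P_1\,\mathrm{stack}_k^1\, P_2)$.
   Context: Let $Q_n=\{1,\dots,n\}$ be a set of $n$ yes/no questions; an outcome on $S\subseteq Q_n$ is an element of $\{0,1\}^{|S|}$, and $X_S$ is the set of outcomes on $S$. A preference matrix on $Q_n$ is a $2^n\times n$ 0-1 matrix whose rows are the $2^n$ outcomes, each exactly once, ordered from most to least preferred. For a nonempty proper $S\subset Q_n$ and outcome $x$ on $Q_n-S$, $P^{[Q_n-S,x]}$ is the submatrix formed by the columns in $S$ and rows with outcome $x$ on $Q_n-S$ (in order); $S$ is separable with respect to $P$ if $P^{[Q_n-S,x]}=P^{[Q_n-S,y]}$ for all $x,y\in X_{Q_n-S}$; $\emptyset$ and $Q_n$ are always separable. The character $\mathrm{char}(P)$ is the set of all subsets of $Q_n$ separable with respect to $P$. $\mathcal{C}(G_n)$ is the set of preference matrices generated by Hamiltonian paths in the $n$-dimensional hypercube graph $G_n$ with Gray code labeling, i.e. preference matrices in which consecutive rows differ in exactly one entry. For $A\in\mathcal{C}(G_n)$, $\mathcal{S}(A)$ is the set of $B\in\mathcal{C}(G_n)$ whose first row equals the last row of $A$. For $B\in\mathcal{S}(A)$ and $k\in\{1,\dots,n+1\}$, $A\,\mathrm{stack}_k^1\,B$ is the $2^{n+1}\times(n+1)$ matrix (a preference matrix on $Q_{n+1}$) obtained by placing $A$ above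 $B$ and inserting a new column in position $k$ (shifting later columns right) whose first $2^n$ entries are $1$ and last $2^n$ entries are $0$. -}

module Defs where

open import Data.Nat using (ℕ; zero; suc; _+_)
open import Data.Bool using (Bool; true; false; not; _xor_; if_then_else_)
import Data.Bool.Properties as BoolP
open import Data.Vec using (Vec; []; _∷_; insertAt)
open import Data.List using (List; []; _∷_; _++_; map; filter; length; head; last)
open import Data.List.Properties using (≡-dec)
open import Data.List.Membership.Propositional using (_∈_)
open import Data.List.Relation.Unary.Unique.Propositional using (Unique)
open import Data.List.Relation.Unary.Linked using (Linked)
open import Data.Fin using (Fin)
open import Data.Fin.Subset using (Subset; ∁; ∣_∣; ⊥; ⊤)
open import Data.Product using (_×_)
open import Data.Sum using (_⊎_)
open import Relation.Binary.PropositionalEquality using (_≡_)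

-- An outcome on Q_n is a 0-1 vector of length n (true = 1, false = 0).
Outcome : ℕ → Set
Outcome n = Vec Bool n

-- A matrix with n columns, given by its list of rows (top row first).
Matrix : ℕ → Set
Matrix n = List (Outcome n)

IsPrefMatrix : (n : ℕ) → Matrix n → Set
IsPrefMatrix n P = (∀ (v : Outcome n) → v ∈ P) × Unique P

restrict : ∀ {n} → Subset n → Outcome n → List Bool
restrict [] [] = []
restrict (true ∷ S) (b ∷ v) = b ∷ restrict S v
restrict (false ∷ S) (b ∷ v) = restrict S v

subMatrix : ∀ {n} → Matrix n → Subset n → List Bool → List (List Bool)
subMatrix P S x = map (restrict S) (filter (λ r → ≡-dec BoolP._≟_ (restrict (∁ S) r) x) P)

Separable : ∀ {n} → Subset n → Matrix n → Set
Separable {n} S P =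
  S ≡ ⊥ ⊎ S ≡ ⊤ ⊎
  (∀ (x y : List Bool) → length x ≡ ∣ ∁ S ∣ → length y ≡ ∣ ∁ S ∣ →
     subMatrix P S x ≡ subMatrix P S y)

_∈char_ : ∀ {n} → Subset n → Matrix n → Set
T ∈char P = Separable T P

hamming : ∀ {n} → Outcome n → Outcome n → ℕ
hamming [] [] = 0
hamming (a ∷ u) (b ∷ v) = (if a xor b then 1 else 0) + hamming u v

Adjacent : ∀ {n} → Outcome n → Outcome n → Set
Adjacent u v = hamming u v ≡ 1

InC : (n : ℕ) → Matrix n → Set
InC n P = IsPrefMatrix n P × Linked Adjacent P

InS : (n : ℕ) → Matrix n → Matrix n → Set
InS n A B = InC n B × head B ≡ last A

-- A stack_k^1 B, with k : Fin (suc n) the 0-based index of the new column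
-- (paper's k ∈ {1,…,n+1} corresponds to toℕ k + 1).
stack : ∀ {n} → Fin (suc n) → Matrix n → Matrix n → Matrix (suc n)
stack k A B = map (λ r → insertAt r k true) A ++ map (λ r → insertAt r k false) B

-- Let r be the last row of P₁, which is also the first row of P₂, and let x and y be the
-- outcomes on Q_{n+1} − T of its copies in the top and bottom halves of the stack. Because
-- k ∉ T, the entry in column k is part of x and y, so the block at x is drawn from the top
-- half only and ends with r restricted to T, while the block at y is drawn from the bottom
-- half only and starts with it. Separability makes the two blocks equal. But the block at
-- y has distinct rows (P₂ has no repeated row) and at least two of them (flip an entry of
-- r in T), so it cannot begin and end with the same row.
module Submission where

open import Defs
open import Data.Nat using (ℕ; suc)
open import Data.Fin using (Fin; zero; suc)
open import Data.Fin.Subset using (Subset; Nonempty; _∉_; _∈_; ∁; ∣_∣)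
open import Data.Fin.Subset.Properties using (∉⊥; ∈⊤; x∈p⇒x∉∁p; x∉p⇒x∈∁p)
open import Relation.Nullary using (¬_; contradiction)
open import Data.Bool using (Bool; true; false; not)
open import Data.Bool.Properties using (_≟_; not-¬)
open import Data.Vec using ([]; _∷_; insertAt; removeAt; lookup; _[_]%=_; replicate; here; there)
open import Data.Vec.Properties using (insertAt-lookup; insertAt-removeAt; removeAt-insertAt; lookup∘updateAt; lookup∘updateAt′)
open import Data.List using (List; []; _∷_; _++_; _∷ʳ_; [_]; map; filter; length; head; last; initLast; _∷ʳ′_)
open import Data.List.Properties using (≡-dec; map-++; filter-++; filter-none; filter-accept; last-map; ++-identityʳ; ∷-injectiveˡ; ∷-injectiveʳ)
open import Data.List.Membership.Propositional using () renaming (_∈_ to _∈ₗ_)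
open import Data.List.Membership.Propositional.Properties using (∈-map⁺; ∈-filter⁺; ∈-++⁺ʳ)
open import Data.List.Relation.Unary.All as All using (All; []; _∷_)
open import Data.List.Relation.Unary.All.Properties using (all-filter) renaming (map⁺ to All-map⁺)
open import Data.List.Relation.Unary.Any using (here)
open import Data.List.Relation.Unary.Any.Properties using (singleton⁻)
open import Data.List.Relation.Unary.AllPairs using ([]; _∷_)
open import Data.List.Relation.Unary.Unique.Propositional using (Unique)
open import Data.List.Relation.Unary.Unique.Propositional.Properties using (filter⁺) renaming (map⁺ to Unique-map⁺)
open import Data.Maybe using (just)
import Data.Maybe as Maybe
open import Data.Product using (_,_; ∃)
open import Data.Sum using (inj₁; inj₂)
open import Function using (_∘_)
open import Relation.Unary using (Decidable)
open import Relation.Binary.PropositionalEquality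
  using (_≡_; _≢_; refl; sym; trans; cong; cong₂; subst; module ≡-Reasoning)

private
  variable
    A B : Set
    n : ℕ

last-∷ʳ : (xs : List A) (x : A) → last (xs ∷ʳ x) ≡ just x
last-∷ʳ []           x = refl
last-∷ʳ (y ∷ [])     x = refl
last-∷ʳ (y ∷ z ∷ xs) x = last-∷ʳ (z ∷ xs) x

last⇒∷ʳ : {xs : List A} {x : A} → last xs ≡ just x → ∃ λ ys → xs ≡ ys ∷ʳ x
last⇒∷ʳ {xs = xs} eq with initLast xs
... | ys ∷ʳ′ y with trans (sym (last-∷ʳ ys y)) eq
...   | refl = ys , refl

last⇒∈ : {xs : List A} {x : A} → last xs ≡ just x → x ∈ₗ xs
last⇒∈ {xs = xs} eq with last⇒∷ʳ {xs = xs} eq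
... | ys , refl = ∈-++⁺ʳ ys (here refl)

last-filter : {Q : A → Set} (Q? : Decidable Q) {xs : List A} {x : A} →
  last xs ≡ just x → Q x → last (filter Q? xs) ≡ just x
last-filter Q? {xs} {x} eq qx with last⇒∷ʳ {xs = xs} eq
... | ys , refl = begin
    last (filter Q? (ys ∷ʳ x))             ≡⟨ cong last (filter-++ Q? ys [ x ]) ⟩
    last (filter Q? ys ++ filter Q? [ x ]) ≡⟨ cong (last ∘ (filter Q? ys ++_)) (filter-accept Q? qx) ⟩
    last (filter Q? ys ∷ʳ x)               ≡⟨ last-∷ʳ (filter Q? ys) x ⟩
    just x                                 ∎
  where open ≡-Reasoning

unique-head≡last⇒singleton : {xs : List A} {x : A} → Unique xs →
  head xs ≡ just x → last xs ≡ just x → xs ≡ [ x ]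
unique-head≡last⇒singleton {xs = x ∷ []}     _               refl _  = refl
unique-head≡last⇒singleton {xs = x ∷ y ∷ ys} (x∉ ∷ _) refl eq =
  contradiction refl (All.lookup x∉ (last⇒∈ eq))

map⁺-injectiveOn : {P : A → Set} (f : A → B) → (∀ {u v} → P u → P v → f u ≡ f v → u ≡ v) →
  {xs : List A} → All P xs → Unique xs → Unique (map f xs)
map⁺-injectiveOn f inj []         []         = []
map⁺-injectiveOn f inj (px ∷ pxs) (x∉ ∷ uxs) =
  All-map⁺ (All.zipWith (λ (x≢y , py) → x≢y ∘ inj px py) (x∉ , pxs))
    ∷ map⁺-injectiveOn f inj pxs uxs

length-restrict : (S : Subset n) (v : Outcome n) → length (restrict S v) ≡ ∣ S ∣
length-restrict []          []      = refl
length-restrict (true ∷ S)  (_ ∷ v) = cong suc (length-restrict S v)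
length-restrict (false ∷ S) (_ ∷ v) = length-restrict S v

restrict-lookup : {S : Subset n} {i : Fin n} (u v : Outcome n) → i ∈ S →
  restrict S u ≡ restrict S v → lookup u i ≡ lookup v i
restrict-lookup {S = true ∷ S}  (a ∷ u) (b ∷ v) here      eq = ∷-injectiveˡ eq
restrict-lookup {S = true ∷ S}  (a ∷ u) (b ∷ v) (there p) eq = restrict-lookup u v p (∷-injectiveʳ eq)
restrict-lookup {S = false ∷ S} (a ∷ u) (b ∷ v) (there p) eq = restrict-lookup u v p eq

restrict-∁-injective : (S : Subset n) (u v : Outcome n) →
  restrict S u ≡ restrict S v → restrict (∁ S) u ≡ restrict (∁ S) v → u ≡ v
restrict-∁-injective []          []      []      _  _  = refl
restrict-∁-injective (true ∷ S)  (a ∷ u) (b ∷ v) eq eq∁ =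
  cong₂ _∷_ (∷-injectiveˡ eq) (restrict-∁-injective S u v (∷-injectiveʳ eq) eq∁)
restrict-∁-injective (false ∷ S) (a ∷ u) (b ∷ v) eq eq∁ =
  cong₂ _∷_ (∷-injectiveˡ eq∁) (restrict-∁-injective S u v eq (∷-injectiveʳ eq∁))

restrict-updateAt-∉ : {S : Subset n} {i : Fin n} (f : Bool → Bool) (w : Outcome n) → i ∉ S →
  restrict S (w [ i ]%= f) ≡ restrict S w
restrict-updateAt-∉ {S = true ∷ S}  {zero}  f (a ∷ w) i∉ = contradiction here i∉
restrict-updateAt-∉ {S = false ∷ S} {zero}  f (a ∷ w) i∉ = refl
restrict-updateAt-∉ {S = true ∷ S}  {suc i} f (a ∷ w) i∉ = cong (a ∷_) (restrict-updateAt-∉ f w (i∉ ∘ there))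
restrict-updateAt-∉ {S = false ∷ S} {suc i} f (a ∷ w) i∉ = restrict-updateAt-∉ f w (i∉ ∘ there)

restrict-updateAt-not : {S : Subset n} {i : Fin n} (w : Outcome n) → i ∈ S →
  restrict S (w [ i ]%= not) ≢ restrict S w
restrict-updateAt-not {i = i} w i∈S eq =
  not-¬ refl (sym (trans (sym (lookup∘updateAt i w)) (restrict-lookup (w [ i ]%= not) w i∈S eq)))

restrict-insertAt-∉ : {S : Subset (suc n)} {k : Fin (suc n)} (u : Outcome n) (b c : Bool) → k ∉ S →
  restrict S (insertAt u k b) ≡ restrict S (insertAt u k c)
restrict-insertAt-∉ {S = true ∷ S}  {zero}  u       b c k∉ = contradiction here k∉
restrict-insertAt-∉ {S = false ∷ S} {zero}  u       b c k∉ = refl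
restrict-insertAt-∉ {S = true ∷ S}  {suc k} (a ∷ u) b c k∉ = cong (a ∷_) (restrict-insertAt-∉ u b c (k∉ ∘ there))
restrict-insertAt-∉ {S = false ∷ S} {suc k} (a ∷ u) b c k∉ = restrict-insertAt-∉ u b c (k∉ ∘ there)

module _ (S : Subset n) (x : List Bool) where

  rowsAt? : Decidable (λ (r : Outcome n) → restrict (∁ S) r ≡ x)
  rowsAt? r = ≡-dec _≟_ (restrict (∁ S) r) x

  subMatrix-++ : (P Q : Matrix n) → subMatrix (P ++ Q) S x ≡ subMatrix P S x ++ subMatrix Q S x
  subMatrix-++ P Q =
    trans (cong (map (restrict S)) (filter-++ rowsAt? P Q))
          (map-++ (restrict S) (filter rowsAt? P) (filter rowsAt? Q))

  subMatrix-none : {P : Matrix n} → All (λ r → restrict (∁ S) r ≢ x) P → subMatrix P S x ≡ []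
  subMatrix-none none = cong (map (restrict S)) (filter-none rowsAt? none)

  ∈-subMatrix : {P : Matrix n} {w : Outcome n} → w ∈ₗ P → restrict (∁ S) w ≡ x →
    restrict S w ∈ₗ subMatrix P S x
  ∈-subMatrix w∈P eq = ∈-map⁺ (restrict S) (∈-filter⁺ rowsAt? w∈P eq)

  subMatrix-unique : {P : Matrix n} → Unique P → Unique (subMatrix P S x)
  subMatrix-unique {P} uniqueP =
    map⁺-injectiveOn (restrict S)
      (λ {u} {v} eqᵤ eqᵥ eq → restrict-∁-injective S u v eq (trans eqᵤ (sym eqᵥ)))
      (all-filter rowsAt? P) (filter⁺ rowsAt? uniqueP)

module _ (S : Subset n) where

  subMatrix-head : {P : Matrix n} {w : Outcome n} → head P ≡ just w →
    head (subMatrix P S (restrict (∁ S) w)) ≡ just (restrict S w)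
  subMatrix-head {P = w ∷ P} refl = cong (head ∘ map (restrict S)) (filter-accept (rowsAt? S _) refl)

  subMatrix-last : {P : Matrix n} {w : Outcome n} → last P ≡ just w →
    last (subMatrix P S (restrict (∁ S) w)) ≡ just (restrict S w)
  subMatrix-last {P} {w} eq =
    trans (last-map (restrict S) (filter (rowsAt? S (restrict (∁ S) w)) P))
          (cong (Maybe.map (restrict S)) (last-filter (rowsAt? S (restrict (∁ S) w)) {P} eq refl))

module _ (k : Fin (suc n)) where

  insertAt-injective : (b : Bool) {u v : Outcome n} → insertAt u k b ≡ insertAt v k b → u ≡ v
  insertAt-injective b {u} {v} eq = begin
    u                              ≡⟨ sym (removeAt-insertAt u k b) ⟩
    removeAt (insertAt u k b) k    ≡⟨ cong (λ w → removeAt w k) eq ⟩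
    removeAt (insertAt v k b) k    ≡⟨ removeAt-insertAt v k b ⟩
    v                              ∎
    where open ≡-Reasoning

  ∈-map-insertAt : {b : Bool} {B : Matrix n} → (∀ v → v ∈ₗ B) → {w : Outcome (suc n)} → lookup w k ≡ b →
    w ∈ₗ map (λ v → insertAt v k b) B
  ∈-map-insertAt {B = B} complete {w} refl = subst (_∈ₗ map insertₖ B) (insertAt-removeAt w k)
    (∈-map⁺ insertₖ (complete (removeAt w k)))
    where
      insertₖ : Outcome n → Outcome (suc n)
      insertₖ v = insertAt v k (lookup w k)

  module _ {T : Subset (suc n)} (k∉T : k ∉ T) where

    restrict-∁-insertAt⇒≡ : (u v : Outcome n) {b c : Bool} →
      restrict (∁ T) (insertAt u k b) ≡ restrict (∁ T) (insertAt v k c) → b ≡ c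
    restrict-∁-insertAt⇒≡ u v {b} {c} eq = begin
      b                            ≡⟨ sym (insertAt-lookup u k b) ⟩
      lookup (insertAt u k b) k    ≡⟨ restrict-lookup (insertAt u k b) (insertAt v k c) (x∉p⇒x∈∁p k∉T) eq ⟩
      lookup (insertAt v k c) k    ≡⟨ insertAt-lookup v k c ⟩
      c                            ∎
      where open ≡-Reasoning

    subMatrix-map-insertAt-≢ : {b c : Bool} → b ≢ c → (u : Outcome n) (B : Matrix n) →
      subMatrix (map (λ v → insertAt v k b) B) T (restrict (∁ T) (insertAt u k c)) ≡ []
    subMatrix-map-insertAt-≢ b≢c u B =
      subMatrix-none T _ (All-map⁺ (All.universal (λ v → b≢c ∘ restrict-∁-insertAt⇒≡ v u) B))

    subMatrix-stack-top : (u : Outcome n) (A B : Matrix n) →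
      let x = restrict (∁ T) (insertAt u k true) in
      subMatrix (stack k A B) T x ≡ subMatrix (map (λ v → insertAt v k true) A) T x
    subMatrix-stack-top u A B = begin
      subMatrix (stack k A B) T x        ≡⟨ subMatrix-++ T x (map (λ v → insertAt v k true) A) _ ⟩
      subMatrix top T x ++ subMatrix (map (λ v → insertAt v k false) B) T x
                                         ≡⟨ cong (subMatrix top T x ++_) (subMatrix-map-insertAt-≢ (λ ()) u B) ⟩
      subMatrix top T x ++ []            ≡⟨ ++-identityʳ _ ⟩
      subMatrix top T x                  ∎
      where
        open ≡-Reasoning
        x = restrict (∁ T) (insertAt u k true)
        top = map (λ v → insertAt v k true) A

    subMatrix-stack-bottom : (u : Outcome n) (A B : Matrix n) →
      let y = restrict (∁ T) (insertAt u k false) in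
      subMatrix (stack k A B) T y ≡ subMatrix (map (λ v → insertAt v k false) B) T y
    subMatrix-stack-bottom u A B =
      trans (subMatrix-++ T y (map (λ v → insertAt v k true) A) bottom)
            (cong (_++ subMatrix bottom T y) (subMatrix-map-insertAt-≢ (λ ()) u A))
      where
        y = restrict (∁ T) (insertAt u k false)
        bottom = map (λ v → insertAt v k false) B

    subMatrix-map-insertAt-≢-singleton : {b : Bool} {B : Matrix n} {i : Fin (suc n)} → (∀ v → v ∈ₗ B) → i ∈ T →
      (w : Outcome (suc n)) → lookup w k ≡ b → (a : List Bool) →
      subMatrix (map (λ v → insertAt v k b) B) T (restrict (∁ T) w) ≢ [ a ]
    subMatrix-map-insertAt-≢-singleton {b} {B} {i} complete i∈T w wₖ≡b a column≡[a] =
      restrict-updateAt-not w i∈T (trans (entry≡a flipped∈column) (sym (entry≡a w∈column)))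
      where
        column = subMatrix (map (λ v → insertAt v k b) B) T (restrict (∁ T) w)
        entry≡a : ∀ {c} → c ∈ₗ column → c ≡ a
        entry≡a {c} c∈column = singleton⁻ (subst (c ∈ₗ_) column≡[a] c∈column)
        w∈column : restrict T w ∈ₗ column
        w∈column = ∈-subMatrix T _ (∈-map-insertAt complete wₖ≡b) refl
        k≢i : k ≢ i
        k≢i k≡i = k∉T (subst (_∈ T) (sym k≡i) i∈T)
        flipped∈column : restrict T (w [ i ]%= not) ∈ₗ column
        flipped∈column = ∈-subMatrix T _
          (∈-map-insertAt complete (trans (lookup∘updateAt′ k i k≢i w) wₖ≡b))
          (restrict-updateAt-∉ not w (x∈p⇒x∉∁p i∈T))

∈char⇒subMatrix-≡ : {T : Subset n} {P : Matrix n} {i j : Fin n} → i ∈ T → j ∉ T → T ∈char P →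
  (u v : Outcome n) → subMatrix P T (restrict (∁ T) u) ≡ subMatrix P T (restrict (∁ T) v)
∈char⇒subMatrix-≡ i∈T j∉T (inj₁ T≡⊥)        u v = contradiction (subst (_ ∈_) T≡⊥ i∈T) ∉⊥
∈char⇒subMatrix-≡ i∈T j∉T (inj₂ (inj₁ T≡⊤)) u v = contradiction (subst (_ ∈_) (sym T≡⊤) ∈⊤) j∉T
∈char⇒subMatrix-≡ {T = T} i∈T j∉T (inj₂ (inj₂ separable)) u v =
  separable _ _ (length-restrict (∁ T) u) (length-restrict (∁ T) v)

lemma6 : (n : ℕ) (P₁ P₂ : Matrix n) → InC n P₁ → InS n P₁ P₂ →
    (k : Fin (suc n)) (T : Subset (suc n)) → Nonempty T → k ∉ T →
    ¬ (T ∈char stack k P₁ P₂)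
lemma6 n P₁ [] _ (((complete₂ , _) , _) , _) k T _ _ _ with complete₂ (replicate n false)
... | ()
lemma6 n P₁ (r ∷ P₂) _ (((complete₂ , unique₂) , _) , r≡last) k T (i , i∈T) k∉T T∈char =
  subMatrix-map-insertAt-≢-singleton k k∉T complete₂ i∈T (insF r) (insertAt-lookup r k false) a column≡[a]
  where
    insT insF : Outcome n → Outcome (suc n)
    insT v = insertAt v k true
    insF v = insertAt v k false
    a = restrict T (insF r)
    P = stack k P₁ (r ∷ P₂)
    column = subMatrix (map insF (r ∷ P₂)) T (restrict (∁ T) (insF r))

    top-column-last : last (subMatrix (map insT P₁) T (restrict (∁ T) (insT r))) ≡ just a
    top-column-last =
      trans (subMatrix-last T {map insT P₁} (trans (last-map insT P₁) (cong (Maybe.map insT) (sym r≡last))))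
            (cong just (restrict-insertAt-∉ r true false k∉T))

    columns-agree : subMatrix (map insT P₁) T (restrict (∁ T) (insT r)) ≡ column
    columns-agree = begin
      subMatrix (map insT P₁) T _  ≡⟨ sym (subMatrix-stack-top k k∉T r P₁ (r ∷ P₂)) ⟩
      subMatrix P T _              ≡⟨ ∈char⇒subMatrix-≡ {P = P} i∈T k∉T T∈char (insT r) (insF r) ⟩
      subMatrix P T _              ≡⟨ subMatrix-stack-bottom k k∉T r P₁ (r ∷ P₂) ⟩
      column                       ∎
      where open ≡-Reasoning

    column≡[a] : column ≡ [ a ]
    column≡[a] = unique-head≡last⇒singleton
      (subMatrix-unique T _ (Unique-map⁺ (insertAt-injective k false) unique₂))
      (subMatrix-head T {map insF (r ∷ P₂)} refl)
      (subst (λ c → last c ≡ just a) columns-agree top-column-last)
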